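{- Let $G$ be one of the following graphs: $K_n$, $P_n$ or $K_{1,n}$ for $n\geq 1$; $C_n$ for $n\geq 3$; the complete multipartite graph $K_{2,m_2,\ldots,m_n}$ for integers $2\leq m_2\leq m_3\leq\cdots\leq m_n$; or the Petersen graph. Then $\gamma_R(\mu(G))=\gamma_R(G)+2$.
   Context: All graphs are finite and simple. $K_n$, $P_n$, $K_{1,n}$, $C_n$ denote the complete graph, path, star and cycle; $K_{2,m_2,\ldots,m_n}$ is the complete $n$-partite graph with parts of sizes $2,m_2,\ldots,m_n$. The Petersen graph has vertex set $\{1,\ldots,10\}$ and edge set $\{\{i,i+1\}:1\leq i\leq 9\}\cup\{\{6,10\},\{1,5\},\{1,9\},\{2,7\},\{3,10\},\{4,8\}\}$. A Roman dominating function (RDF) of $G=(V,E)$ is a function $f:V\to\{0,1,2\}$ such that every vertex $v$ with $f(v)=0$ has a neighbor $w$ with $f(w)=2$; its weight is $\sum_v f(v)$ and $\gamma_R(G)$ is the minimum weight of an RDF. The Mycielskian $\mu(G)$ of $G$ with $V(G)=\{v_1^0,\ldots,v_N^0\}$ has vertex set $\{v_j^0\}\cup\{v_j^1\}\cup\{u\}$ and edge set $E(G)\cup\{v_j^0v_{j'}^1 : v_j^0v_{j'}^0\in E(G)\}\cup\{v_j^1u: 1\leq j\leq N\}$. -}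

module Defs where

open import Data.Nat using (ℕ; zero; suc; _+_; _≤_; _≡ᵇ_)
open import Data.Bool using (Bool; true; false; _∨_; _∧_; not)
open import Data.Fin using (Fin; zero; suc; toℕ; splitAt)
open import Data.Sum using (_⊎_; inj₁; inj₂)
open import Data.Product using (Σ; _×_; _,_; ∃-syntax)
open import Data.List using (List; []; _∷_)
open import Data.Bool.ListAction using (any)
open import Relation.Binary.PropositionalEquality using (_≡_)

-- A finite graph on the vertex set Fin order, given by a Boolean adjacency
-- function. All concrete graphs below (and their Mycielskians) are
-- symmetric and loopless, i.e. simple graphs.
record Graph : Set where
  field
    order : ℕ
    adj   : Fin order → Fin order → Bool
open Graph public


ΣFin : (n : ℕ) → (Fin n → ℕ) → ℕ
ΣFin zero    f = 0
ΣFin (suc n) f = f zero + ΣFin n (λ i → f (suc i))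

IsRDF : (G : Graph) → (Fin (order G) → ℕ) → Set
IsRDF G f =
  ((v : Fin (order G)) → f v ≤ 2) ×
  ((v : Fin (order G)) → f v ≡ 0 →
     ∃[ w ] (adj G v w ≡ true × f w ≡ 2))

weight : (G : Graph) → (Fin (order G) → ℕ) → ℕ
weight G f = ΣFin (order G) f

RomanDominationNumber : Graph → ℕ → Set
RomanDominationNumber G k =
  (∃[ f ] (IsRDF G f × weight G f ≡ k)) ×
  ((f : Fin (order G) → ℕ) → IsRDF G f → k ≤ weight G f)

-- Mycielskian: vertices v_j^0 = first N, v_j^1 = next N, u = last one

data MVertex (N : ℕ) : Set where
  old : Fin N → MVertex N
  new : Fin N → MVertex N
  hub : MVertex N

decode : (N : ℕ) → Fin ((N + N) + 1) → MVertex N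
decode N i with splitAt (N + N) i
... | inj₂ _ = hub
... | inj₁ j with splitAt N j
...   | inj₁ a = old a
...   | inj₂ b = new b

mycielskiAdj : (G : Graph) → MVertex (order G) → MVertex (order G) → Bool
mycielskiAdj G (old i) (old j) = adj G i j
mycielskiAdj G (old i) (new j) = adj G i j
mycielskiAdj G (new i) (old j) = adj G j i
mycielskiAdj G (new i) (new j) = false
mycielskiAdj G (new i) hub     = true
mycielskiAdj G hub     (new j) = true
mycielskiAdj G (old i) hub     = false
mycielskiAdj G hub     (old j) = false
mycielskiAdj G hub     hub     = false

μ : Graph → Graph
μ G = record
  { order = (order G + order G) + 1
  ; adj   = λ i j → mycielskiAdj G (decode (order G) i) (decode (order G) j)
  }

-- The graph families (vertex i ∈ Fin n stands for vertex i+1 of the paper)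

neq : ∀ {n} → Fin n → Fin n → Bool
neq i j = not (toℕ i ≡ᵇ toℕ j)

completeGraph : ℕ → Graph
completeGraph n = record { order = n ; adj = neq }

consecutive : ∀ {n} → Fin n → Fin n → Bool
consecutive i j = (suc (toℕ i) ≡ᵇ toℕ j) ∨ (suc (toℕ j) ≡ᵇ toℕ i)

pathGraph : ℕ → Graph
pathGraph n = record { order = n ; adj = consecutive }

starAdj : ∀ {n} → Fin (suc n) → Fin (suc n) → Bool
starAdj zero    zero    = false
starAdj zero    (suc _) = true
starAdj (suc _) zero    = true
starAdj (suc _) (suc _) = false

starGraph : ℕ → Graph
starGraph n = record { order = suc n ; adj = starAdj }

cycleAdj : (n : ℕ) → Fin n → Fin n → Bool
cycleAdj n i j =
  consecutive i j ∨
  ((toℕ i ≡ᵇ 0) ∧ (suc (toℕ j) ≡ᵇ n)) ∨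
  ((toℕ j ≡ᵇ 0) ∧ (suc (toℕ i) ≡ᵇ n))

cycleGraph : ℕ → Graph
cycleGraph n = record { order = n ; adj = cycleAdj n }

sumL : List ℕ → ℕ
sumL []       = 0
sumL (s ∷ ss) = s + sumL ss

partOf : (sizes : List ℕ) → Fin (sumL sizes) → ℕ
partOf []       ()
partOf (s ∷ ss) i with splitAt s i
... | inj₁ _ = 0
... | inj₂ j = suc (partOf ss j)

completeMultipartite : List ℕ → Graph
completeMultipartite sizes = record
  { order = sumL sizes
  ; adj   = λ i j → not (partOf sizes i ≡ᵇ partOf sizes j)
  }

-- Petersen graph, edges as in the paper (1-based labels)
petersenEdges : List (ℕ × ℕ)
petersenEdges =
  (1 , 2) ∷ (2 , 3) ∷ (3 , 4) ∷ (4 , 5) ∷ (5 , 6) ∷ (6 , 7) ∷ (7 , 8) ∷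
  (8 , 9) ∷ (9 , 10) ∷ (6 , 10) ∷ (1 , 5) ∷ (1 , 9) ∷ (2 , 7) ∷
  (3 , 10) ∷ (4 , 8) ∷ []

edgeMatches : ℕ → ℕ → ℕ × ℕ → Bool
edgeMatches a b (x , y) = ((a ≡ᵇ x) ∧ (b ≡ᵇ y)) ∨ ((a ≡ᵇ y) ∧ (b ≡ᵇ x))

petersen : Graph
petersen = record
  { order = 10
  ; adj   = λ i j → any (edgeMatches (suc (toℕ i)) (suc (toℕ j))) petersenEdges
  }

-- For γR(μ G) ≤ γR(G) + 2, put a minimum RDF of G on the original vertices and 2 on the hub u.
-- Conversely, fold an RDF h of μ G onto G by giving v the value h(v) ⊔ h(v′), v′ the twin of v.
-- The fold is an RDF of G, which settles the case h(u) = 2.  If h(u) < 2 and some twin p′ has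
-- weight 2, the fold without that 2 is still an RDF, because h(u) ≠ 2 forces every twin of weight
-- 0 to have an original neighbour of weight 2; this saves 2.  Otherwise h(u) = 1 and the originals
-- alone form an RDF of G, which weighs more than γR(G) unless every twin has weight 0 -- and then
-- the vertices of weight 2 dominate every vertex of G, including each other.  So everything
-- reduces to showing that such an RDF of G is heavier than γR(G).  This holds when γR(G) ≤ 3,
-- since it has two adjacent 2s; when G has maximum degree 2, since the 2 on a vertex t with a
-- neighbour of weight 2 can be replaced by a 1 on the other neighbour of t; and for the 3-regular
-- Petersen graph, where double counting gives at least ⌈10/3⌉ = 4 vertices of weight 2.
module Submission where

open import Defs
open import Data.Bool using (Bool; true; false; not; _∨_; _∧_; if_then_else_)
open import Data.Bool.Properties using (T-≡; ∨-comm) renaming (_≟_ to _≟ᵇ_)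
open import Data.Empty using (⊥; ⊥-elim)
open import Data.Fin using (Fin; zero; suc; toℕ; _↑ˡ_; _↑ʳ_; splitAt) renaming (_≟_ to _≟ᶠ_)
open import Data.Fin.Properties
  using (splitAt-↑ˡ; splitAt-↑ʳ; splitAt⁻¹-↑ˡ; splitAt⁻¹-↑ʳ; toℕ-injective; toℕ<n; any?; all?)
open import Data.List using (_∷_)
open import Data.List.Relation.Unary.Linked using (Linked)
open import Data.Nat using (ℕ; zero; suc; pred; _+_; _*_; _≤_; _<_; _⊔_; _≡ᵇ_; z≤n; s≤s; _≟_; _≤?_)
open import Data.Nat.Properties
open import Algebra.Properties.CommutativeSemigroup +-commutativeSemigroup using (interchange; xy∙z≈zy∙x)
open import Data.Product using (_×_; _,_; ∃-syntax; proj₁; proj₂)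
open import Data.Sum using (_⊎_; inj₁; inj₂; map₂; reduce)
open import Data.Vec.Functional using (updateAt)
open import Data.Vec.Functional.Properties using (updateAt-updates; updateAt-minimal)
open import Function using (_∘_; const; Equivalence)
open import Relation.Nullary using (¬_; yes; no; ¬?)
open import Relation.Nullary.Decidable using (from-yes; _×-dec_; _→-dec_)
open import Relation.Binary.PropositionalEquality
  using (_≡_; _≢_; refl; sym; trans; cong; cong₂; subst; module ≡-Reasoning)

ΣFin-cong : ∀ n {f g : Fin n → ℕ} → (∀ i → f i ≡ g i) → ΣFin n f ≡ ΣFin n g
ΣFin-cong zero    e = refl
ΣFin-cong (suc n) e = cong₂ _+_ (e zero) (ΣFin-cong n (e ∘ suc))

ΣFin-mono : ∀ n {f g : Fin n → ℕ} → (∀ i → f i ≤ g i) → ΣFin n f ≤ ΣFin n g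
ΣFin-mono zero    le = z≤n
ΣFin-mono (suc n) le = +-mono-≤ (le zero) (ΣFin-mono n (le ∘ suc))

ΣFin-const : ∀ n c → ΣFin n (λ _ → c) ≡ n * c
ΣFin-const zero    c = refl
ΣFin-const (suc n) c = cong (c +_) (ΣFin-const n c)

ΣFin-zero : ∀ n → ΣFin n (λ _ → 0) ≡ 0
ΣFin-zero n = trans (ΣFin-const n 0) (*-zeroʳ n)

ΣFin-+ : ∀ n (f g : Fin n → ℕ) → ΣFin n (λ i → f i + g i) ≡ ΣFin n f + ΣFin n g
ΣFin-+ zero    f g = refl
ΣFin-+ (suc n) f g =
  trans (cong (f zero + g zero +_) (ΣFin-+ n (f ∘ suc) (g ∘ suc)))
        (interchange (f zero) (g zero) (ΣFin n (f ∘ suc)) (ΣFin n (g ∘ suc)))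

ΣFin-*ˡ : ∀ n c (f : Fin n → ℕ) → ΣFin n (λ i → c * f i) ≡ c * ΣFin n f
ΣFin-*ˡ zero    c f = sym (*-zeroʳ c)
ΣFin-*ˡ (suc n) c f =
  trans (cong (c * f zero +_) (ΣFin-*ˡ n c (f ∘ suc))) (sym (*-distribˡ-+ c (f zero) _))

ΣFin-comm : ∀ m n (f : Fin m → Fin n → ℕ) →
  ΣFin m (λ i → ΣFin n (f i)) ≡ ΣFin n (λ j → ΣFin m (λ i → f i j))
ΣFin-comm zero    n f = sym (ΣFin-zero n)
ΣFin-comm (suc m) n f =
  trans (cong (ΣFin n (f zero) +_) (ΣFin-comm m n (f ∘ suc)))
        (sym (ΣFin-+ n (f zero) (λ j → ΣFin m (λ i → f (suc i) j))))

ΣFin-↑ : ∀ m n (f : Fin (m + n) → ℕ) →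
  ΣFin (m + n) f ≡ ΣFin m (λ i → f (i ↑ˡ n)) + ΣFin n (λ j → f (m ↑ʳ j))
ΣFin-↑ zero    n f = refl
ΣFin-↑ (suc m) n f =
  trans (cong (f zero +_) (ΣFin-↑ m n (f ∘ suc))) (sym (+-assoc (f zero) _ _))

ΣFin-updateAt : ∀ n (f : Fin n → ℕ) p (g : ℕ → ℕ) →
  ΣFin n (updateAt f p g) + f p ≡ ΣFin n f + g (f p)
ΣFin-updateAt (suc n) f zero    g = xy∙z≈zy∙x (g (f zero)) (ΣFin n (f ∘ suc)) (f zero)
ΣFin-updateAt (suc n) f (suc p) g = begin
  f zero + ΣFin n (updateAt (f ∘ suc) p g) + f (suc p)   ≡⟨ +-assoc (f zero) _ _ ⟩
  f zero + (ΣFin n (updateAt (f ∘ suc) p g) + f (suc p)) ≡⟨ cong (f zero +_) (ΣFin-updateAt n (f ∘ suc) p g) ⟩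
  f zero + (ΣFin n (f ∘ suc) + g (f (suc p)))            ≡⟨ +-assoc (f zero) _ _ ⟨
  f zero + ΣFin n (f ∘ suc) + g (f (suc p))              ∎
  where open ≡-Reasoning

ΣFin-term : ∀ n (f : Fin n → ℕ) i → f i ≤ ΣFin n f
ΣFin-term n f i = ≤-trans (m≤n+m (f i) _)
  (≤-reflexive (trans (ΣFin-updateAt n f i (const 0)) (+-identityʳ _)))

ΣFin-pair : ∀ n (f : Fin n → ℕ) {i j} → i ≢ j → f i + f j ≤ ΣFin n f
ΣFin-pair n f {i} {j} i≢j = begin
  f i + f j                   ≡⟨ cong (f i +_) (updateAt-minimal j i f (i≢j ∘ sym)) ⟨
  f i + f′ j                  ≤⟨ +-monoʳ-≤ (f i) (ΣFin-term n f′ j) ⟩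
  f i + ΣFin n f′             ≡⟨ +-comm (f i) _ ⟩
  ΣFin n f′ + f i             ≡⟨ ΣFin-updateAt n f i (const 0) ⟩
  ΣFin n f + 0                ≡⟨ +-identityʳ _ ⟩
  ΣFin n f                    ∎
  where
  open ≤-Reasoning
  f′ = updateAt f i (const 0)

Symmetric : Graph → Set
Symmetric G = ∀ i j → adj G i j ≡ true → adj G j i ≡ true

Irreflexive : Graph → Set
Irreflexive G = ∀ i → ¬ adj G i i ≡ true

RDFsWeighAtLeast : Graph → ℕ → Set
RDFsWeighAtLeast G k = (f : Fin (order G) → ℕ) → IsRDF G f → k ≤ weight G f

TwosDominateTotally : (G : Graph) → (Fin (order G) → ℕ) → Set
TwosDominateTotally G f = ∀ v → ∃[ w ] (adj G v w ≡ true × f w ≡ 2)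

TotalRDFsExceed : Graph → ℕ → Set
TotalRDFsExceed G k =
  (f : Fin (order G) → ℕ) → IsRDF G f → TwosDominateTotally G f → k < weight G f

⊔≡2 : ∀ {a b} → a ≤ 2 → b ≤ 2 → a ≡ 2 ⊎ b ≡ 2 → a ⊔ b ≡ 2
⊔≡2 {a} {b} a≤2 b≤2 two = ≤-antisym (⊔-lub a≤2 b≤2) (twoBelow two)
  where
  twoBelow : a ≡ 2 ⊎ b ≡ 2 → 2 ≤ a ⊔ b
  twoBelow (inj₁ refl) = m≤m⊔n 2 b
  twoBelow (inj₂ refl) = m≤n⊔m a 2

⊔≡0ˡ : ∀ a b → a ⊔ b ≡ 0 → a ≡ 0
⊔≡0ˡ a b e = n≤0⇒n≡0 (subst (a ≤_) e (m≤m⊔n a b))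

⊔≡0ʳ : ∀ a b → a ⊔ b ≡ 0 → b ≡ 0
⊔≡0ʳ a b e = n≤0⇒n≡0 (subst (b ≤_) e (m≤n⊔m a b))

⊔-IsRDF : (G : Graph) (x z : Fin (order G) → ℕ) →
  (∀ j → x j ≤ 2) → (∀ j → z j ≤ 2) →
  (∀ j → x j ⊔ z j ≡ 0 → ∃[ q ] (adj G j q ≡ true × (x q ≡ 2 ⊎ z q ≡ 2))) →
  IsRDF G (λ j → x j ⊔ z j)
⊔-IsRDF G x z x≤2 z≤2 dom = (λ j → ⊔-lub (x≤2 j) (z≤2 j)) , λ j e →
  let q , jq , two = dom j e in q , jq , ⊔≡2 (x≤2 q) (z≤2 q) two

weight-⊔ : (G : Graph) (x z : Fin (order G) → ℕ) →
  weight G (λ j → x j ⊔ z j) ≤ weight G x + weight G z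
weight-⊔ G x z = ≤-trans (ΣFin-mono (order G) (λ j → m⊔n≤m+n (x j) (z j)))
                         (≤-reflexive (ΣFin-+ (order G) x z))

encode : (N : ℕ) → MVertex N → Fin ((N + N) + 1)
encode N (old i) = (i ↑ˡ N) ↑ˡ 1
encode N (new j) = (N ↑ʳ j) ↑ˡ 1
encode N hub     = (N + N) ↑ʳ zero

decode-encode : ∀ N m → decode N (encode N m) ≡ m
decode-encode N (old i) rewrite splitAt-↑ˡ (N + N) (i ↑ˡ N) 1 | splitAt-↑ˡ N i N = refl
decode-encode N (new j) rewrite splitAt-↑ˡ (N + N) (N ↑ʳ j) 1 | splitAt-↑ʳ N N j = refl
decode-encode N hub     rewrite splitAt-↑ʳ (N + N) 1 zero = refl

encode-decode : ∀ N i → encode N (decode N i) ≡ i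
encode-decode N i with splitAt (N + N) i in eq
... | inj₂ zero = splitAt⁻¹-↑ʳ eq
... | inj₁ j with splitAt N j in eq′
...   | inj₁ a = trans (cong (_↑ˡ 1) (splitAt⁻¹-↑ˡ eq′)) (splitAt⁻¹-↑ˡ eq)
...   | inj₂ b = trans (cong (_↑ˡ 1) (splitAt⁻¹-↑ʳ eq′)) (splitAt⁻¹-↑ˡ eq)

IsMycielskiRDF : (G : Graph) → (MVertex (order G) → ℕ) → Set
IsMycielskiRDF G h =
  ((m : MVertex (order G)) → h m ≤ 2) ×
  ((m : MVertex (order G)) → h m ≡ 0 → ∃[ m′ ] (mycielskiAdj G m m′ ≡ true × h m′ ≡ 2))

mycielskiWeight : (G : Graph) → (MVertex (order G) → ℕ) → ℕ
mycielskiWeight G h = ΣFin (order G) (h ∘ old) + ΣFin (order G) (h ∘ new) + h hub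

IsRDF-μ⁺ : (G : Graph) {h : MVertex (order G) → ℕ} →
  IsMycielskiRDF G h → IsRDF (μ G) (h ∘ decode (order G))
IsRDF-μ⁺ G {h} (h≤2 , dom) = h≤2 ∘ decode N , λ i e →
  let m′ , am′ , hm′ = dom (decode N i) e
      back = decode-encode N m′
  in encode N m′ , subst (λ m → mycielskiAdj G (decode N i) m ≡ true) (sym back) am′
                 , trans (cong h back) hm′
  where N = order G

IsRDF-μ⁻ : (G : Graph) {g : Fin (order (μ G)) → ℕ} →
  IsRDF (μ G) g → IsMycielskiRDF G (g ∘ encode (order G))
IsRDF-μ⁻ G {g} (g≤2 , dom) = g≤2 ∘ encode N , λ m e →
  let w , aw , gw = dom (encode N m) e
  in decode N w , subst (λ m′ → mycielskiAdj G m′ (decode N w) ≡ true) (decode-encode N m) aw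
                , trans (cong g (encode-decode N w)) gw
  where N = order G

weight-μ : (G : Graph) (h : MVertex (order G) → ℕ) →
  weight (μ G) (h ∘ decode (order G)) ≡ mycielskiWeight G h
weight-μ G h = begin
  ΣFin (N + N + 1) (h ∘ decode N)
    ≡⟨ ΣFin-↑ (N + N) 1 (h ∘ decode N) ⟩
  ΣFin (N + N) (λ i → h (decode N (i ↑ˡ 1))) + (h (decode N (encode N hub)) + 0)
    ≡⟨ cong₂ _+_ (ΣFin-↑ N N (λ i → h (decode N (i ↑ˡ 1))))
                 (trans (+-identityʳ _) (cong h (decode-encode N hub))) ⟩
  ΣFin N (λ i → h (decode N (encode N (old i)))) + ΣFin N (λ i → h (decode N (encode N (new i)))) + h hub
    ≡⟨ cong (λ s → s + h hub)
            (cong₂ _+_ (ΣFin-cong N (cong h ∘ decode-encode N ∘ old))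
                       (ΣFin-cong N (cong h ∘ decode-encode N ∘ new))) ⟩
  mycielskiWeight G h ∎
  where
  N = order G
  open ≡-Reasoning

weight-μ-encode : (G : Graph) (g : Fin (order (μ G)) → ℕ) →
  weight (μ G) g ≡ mycielskiWeight G (g ∘ encode (order G))
weight-μ-encode G g =
  trans (ΣFin-cong (order (μ G)) (λ i → cong g (sym (encode-decode (order G) i))))
        (weight-μ G (g ∘ encode (order G)))

hubExtension : {N : ℕ} → (Fin N → ℕ) → MVertex N → ℕ
hubExtension f (old i) = f i
hubExtension f (new i) = 0
hubExtension f hub     = 2

hubExtension-IsMycielskiRDF : (G : Graph) {f : Fin (order G) → ℕ} →
  IsRDF G f → IsMycielskiRDF G (hubExtension f)
hubExtension-IsMycielskiRDF G {f} (f≤2 , dom) = bounded , dominated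
  where
  bounded : ∀ m → hubExtension f m ≤ 2
  bounded (old i) = f≤2 i
  bounded (new i) = z≤n
  bounded hub     = ≤-refl
  dominated : ∀ m → hubExtension f m ≡ 0 →
    ∃[ m′ ] (mycielskiAdj G m m′ ≡ true × hubExtension f m′ ≡ 2)
  dominated (old i) e = let q , iq , fq = dom i e in old q , iq , fq
  dominated (new i) e = hub , refl , refl

hubExtension-weight : (G : Graph) (f : Fin (order G) → ℕ) →
  mycielskiWeight G (hubExtension f) ≡ weight G f + 2
hubExtension-weight G f =
  trans (cong (λ s → weight G f + s + 2) (ΣFin-zero (order G)))
        (cong (_+ 2) (+-identityʳ _))

module MycielskiLowerBound
  {G : Graph} (G-sym : Symmetric G) (G-irr : Irreflexive G) {k : ℕ}
  (atLeast : RDFsWeighAtLeast G k) (exceed : TotalRDFsExceed G k)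
  {h : MVertex (order G) → ℕ} (hRDF : IsMycielskiRDF G h) where

  private
    N = order G
    x y : Fin N → ℕ
    x = h ∘ old
    y = h ∘ new
    bounded = proj₁ hRDF
    dominated = proj₂ hRDF

  old-dominated : ∀ j → x j ≡ 0 → ∃[ q ] (adj G j q ≡ true × (x q ≡ 2 ⊎ y q ≡ 2))
  old-dominated j e with dominated (old j) e
  ... | old q , jq , two = q , jq , inj₁ two
  ... | new q , jq , two = q , jq , inj₂ two

  new-dominated : h hub ≢ 2 → ∀ j → y j ≡ 0 → ∃[ q ] (adj G j q ≡ true × x q ≡ 2)
  new-dominated hub≢2 j e with dominated (new j) e
  ... | old q , qj , two = q , G-sym q j qj , two
  ... | hub   , _  , two = ⊥-elim (hub≢2 two)

  hub-dominated : h hub ≡ 0 → ∃[ p ] (y p ≡ 2)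
  hub-dominated e with dominated hub e
  ... | new p , _ , two = p , two

  x-IsRDF : (∀ p → y p ≢ 2) → IsRDF G x
  x-IsRDF noTwin = bounded ∘ old , dom
    where
    dom : ∀ j → x j ≡ 0 → ∃[ q ] (adj G j q ≡ true × x q ≡ 2)
    dom j e with old-dominated j e
    ... | q , jq , inj₁ two = q , jq , two
    ... | q , _  , inj₂ two = ⊥-elim (noTwin q two)

  hub≢ : ∀ {a} → h hub ≡ a → a ≢ 2 → h hub ≢ 2
  hub≢ hub≡a a≢2 hub≡2 = a≢2 (trans (sym hub≡a) hub≡2)

  merged-bound : k ≤ ΣFin N x + ΣFin N y
  merged-bound = ≤-trans (atLeast _ merged-IsRDF) (weight-⊔ G x y)
    where
    merged-IsRDF : IsRDF G (λ j → x j ⊔ y j)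
    merged-IsRDF = ⊔-IsRDF G x y (bounded ∘ old) (bounded ∘ new)
                     (λ j e → old-dominated j (⊔≡0ˡ (x j) (y j) e))

  twin-bound : h hub ≢ 2 → ∀ p → y p ≡ 2 → k + 2 ≤ ΣFin N x + ΣFin N y
  twin-bound hub≢2 p yp = begin
    k + 2                 ≤⟨ +-monoˡ-≤ 2 (atLeast _ ψ-IsRDF) ⟩
    weight G ψ + 2        ≤⟨ +-monoˡ-≤ 2 (weight-⊔ G x z) ⟩
    ΣFin N x + ΣFin N z + 2 ≡⟨ +-assoc (ΣFin N x) _ _ ⟩
    ΣFin N x + (ΣFin N z + 2) ≡⟨ cong (ΣFin N x +_) Σz+2 ⟩
    ΣFin N x + ΣFin N y   ∎
    where
    open ≤-Reasoning
    z ψ : Fin N → ℕ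
    z = updateAt y p (const 0)
    ψ j = x j ⊔ z j
    Σz+2 : ΣFin N z + 2 ≡ ΣFin N y
    Σz+2 = trans (cong (ΣFin N z +_) (sym yp))
                 (trans (ΣFin-updateAt N y p (const 0)) (+-identityʳ _))
    z-off : ∀ j → j ≢ p → z j ≡ y j
    z-off j j≢p = updateAt-minimal j p y j≢p
    z≤2 : ∀ j → z j ≤ 2
    z≤2 j with j ≟ᶠ p
    ... | yes refl = subst (_≤ 2) (sym (updateAt-updates p y)) z≤n
    ... | no j≢p   = subst (_≤ 2) (sym (z-off j j≢p)) (bounded (new j))
    dom : ∀ j → x j ⊔ z j ≡ 0 → ∃[ q ] (adj G j q ≡ true × (x q ≡ 2 ⊎ z q ≡ 2))
    dom j e with j ≟ᶠ p
    dom j e | no j≢p with new-dominated hub≢2 j (trans (sym (z-off j j≢p)) (⊔≡0ʳ (x j) (z j) e))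
    ... | q , jq , two = q , jq , inj₁ two
    dom j e | yes refl with old-dominated j (⊔≡0ˡ (x j) (z j) e)
    ... | q , jq , two = q , jq , map₂ (trans (z-off q q≢j)) two
      where
      q≢j : q ≢ j
      q≢j refl = G-irr j jq
    ψ-IsRDF : IsRDF G ψ
    ψ-IsRDF = ⊔-IsRDF G x z (bounded ∘ old) z≤2 dom

  noTwin-bound : h hub ≢ 2 → (∀ p → y p ≢ 2) → k < ΣFin N x + ΣFin N y
  noTwin-bound hub≢2 noTwin with ΣFin N y in Σy
  ... | zero = subst (k <_) (sym (+-identityʳ _)) (exceed x (x-IsRDF noTwin) totally)
    where
    totally : TwosDominateTotally G x
    totally v = new-dominated hub≢2 v (n≤0⇒n≡0 (subst (y v ≤_) Σy (ΣFin-term N y v)))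
  ... | suc s = subst (k <_) (sym (+-suc _ s))
                  (s≤s (≤-trans (atLeast x (x-IsRDF noTwin)) (m≤m+n _ s)))

  lowerBound : k + 2 ≤ ΣFin N x + ΣFin N y + h hub
  lowerBound with h hub in hub≡ | bounded hub
  ... | 2 | _ = +-monoˡ-≤ 2 merged-bound
  ... | 0 | _ = let p , yp = hub-dominated hub≡ in
    subst (k + 2 ≤_) (sym (+-identityʳ _)) (twin-bound (hub≢ hub≡ λ ()) p yp)
  ... | 1 | _ with any? (λ p → y p ≟ 2)
  ...   | yes (p , yp) = ≤-trans (twin-bound (hub≢ hub≡ λ ()) p yp) (m≤m+n _ 1)
  ...   | no noTwin    = subst (_≤ ΣFin N x + ΣFin N y + 1) (sym (+-suc k 1))
                           (+-monoˡ-≤ 1 (noTwin-bound (hub≢ hub≡ λ ()) λ p yp → noTwin (p , yp)))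
  lowerBound | suc (suc (suc _)) | s≤s (s≤s ())

γR-μ : {G : Graph} → Symmetric G → Irreflexive G → {k : ℕ} →
  RomanDominationNumber G k → TotalRDFsExceed G k → RomanDominationNumber (μ G) (k + 2)
γR-μ {G} G-sym G-irr ((f , f-IsRDF , refl) , atLeast) exceed =
  ( hubExtension f ∘ decode (order G)
  , IsRDF-μ⁺ G (hubExtension-IsMycielskiRDF G f-IsRDF)
  , trans (weight-μ G (hubExtension f)) (hubExtension-weight G f) )
  , λ g g-IsRDF → subst (_ ≤_) (sym (weight-μ-encode G g))
      (MycielskiLowerBound.lowerBound G-sym G-irr atLeast exceed (IsRDF-μ⁻ G g-IsRDF))

isTwo : ℕ → ℕ
isTwo 2 = 1
isTwo _ = 0

twos : {n : ℕ} → (Fin n → ℕ) → ℕ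
twos {n} f = ΣFin n (isTwo ∘ f)

2*twos≤ΣFin : ∀ n (f : Fin n → ℕ) → 2 * twos f ≤ ΣFin n f
2*twos≤ΣFin n f = ≤-trans (≤-reflexive (sym (ΣFin-*ˡ n 2 (isTwo ∘ f)))) (ΣFin-mono n (2*isTwo≤ ∘ f))
  where
  2*isTwo≤ : ∀ a → 2 * isTwo a ≤ a
  2*isTwo≤ 0                 = z≤n
  2*isTwo≤ 1                 = z≤n
  2*isTwo≤ 2                 = ≤-refl
  2*isTwo≤ (suc (suc (suc a))) = z≤n

twos≥2 : (G : Graph) → Irreflexive G → Fin (order G) →
  (f : Fin (order G) → ℕ) → TwosDominateTotally G f → 2 ≤ twos f
twos≥2 G G-irr v f totally with totally v
... | w , _ , fw with totally w
... | w′ , ww′ , fw′ =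
  subst (_≤ twos f) (cong₂ _+_ (cong isTwo fw) (cong isTwo fw′)) (ΣFin-pair (order G) (isTwo ∘ f) w≢w′)
  where
  w≢w′ : w ≢ w′
  w≢w′ refl = G-irr w ww′

γR≤3⇒TotalRDFsExceed : (G : Graph) → Irreflexive G → Fin (order G) →
  ∀ {k} → k ≤ 3 → TotalRDFsExceed G k
γR≤3⇒TotalRDFsExceed G G-irr v k≤3 f _ totally =
  ≤-trans (s≤s k≤3) (≤-trans (*-monoʳ-≤ 2 (twos≥2 G G-irr v f totally)) (2*twos≤ΣFin (order G) f))

degree : (G : Graph) → Fin (order G) → ℕ
degree G w = ΣFin (order G) (λ v → if adj G v w then 1 else 0)

order≤degree*twos : (G : Graph) {d : ℕ} → (∀ w → degree G w ≤ d) →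
  (f : Fin (order G) → ℕ) → TwosDominateTotally G f → order G ≤ d * twos f
order≤degree*twos G {d} degree≤d f totally = begin
  N                                          ≡⟨ trans (ΣFin-const N 1) (*-identityʳ N) ⟨
  ΣFin N (λ _ → 1)                           ≤⟨ ΣFin-mono N seesTwo ⟩
  ΣFin N (λ v → ΣFin N (λ w → seen v w))     ≡⟨ ΣFin-comm N N seen ⟩
  ΣFin N (λ w → ΣFin N (λ v → seen v w))     ≡⟨ ΣFin-cong N (λ w → ΣFin-*ˡ N (isTwo (f w)) _) ⟩
  ΣFin N (λ w → isTwo (f w) * degree G w)    ≤⟨ ΣFin-mono N (λ w → *-monoʳ-≤ (isTwo (f w)) (degree≤d w)) ⟩
  ΣFin N (λ w → isTwo (f w) * d)             ≡⟨ ΣFin-cong N (λ w → *-comm (isTwo (f w)) d) ⟩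
  ΣFin N (λ w → d * isTwo (f w))             ≡⟨ ΣFin-*ˡ N d (isTwo ∘ f) ⟩
  d * twos f                                 ∎
  where
  open ≤-Reasoning
  N = order G
  seen : Fin N → Fin N → ℕ
  seen v w = isTwo (f w) * (if adj G v w then 1 else 0)
  seesTwo : ∀ v → 1 ≤ ΣFin N (seen v)
  seesTwo v with totally v
  ... | w , vw , fw = ≤-trans (≤-reflexive (sym seen≡1)) (ΣFin-term N (seen v) w)
    where
    seen≡1 : seen v w ≡ 1
    seen≡1 rewrite vw | fw = refl

MaxDegree≤2 : Graph → Set
MaxDegree≤2 G = ∀ t → ∃[ p ] ∃[ q ] (∀ a → adj G t a ≡ true → toℕ a ≡ p ⊎ toℕ a ≡ q)

pigeonhole-pair : {A : Set} {p q s a b : A} → s ≡ p ⊎ s ≡ q → a ≡ p ⊎ a ≡ q → b ≡ p ⊎ b ≡ q →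
  a ≢ s → b ≢ s → a ≡ b
pigeonhole-pair (inj₁ refl) (inj₁ refl) _           a≢s _   = ⊥-elim (a≢s refl)
pigeonhole-pair (inj₁ refl) (inj₂ refl) (inj₁ refl) _   b≢s = ⊥-elim (b≢s refl)
pigeonhole-pair (inj₁ refl) (inj₂ refl) (inj₂ refl) _   _   = refl
pigeonhole-pair (inj₂ refl) (inj₂ refl) _           a≢s _   = ⊥-elim (a≢s refl)
pigeonhole-pair (inj₂ refl) (inj₁ refl) (inj₂ refl) _   b≢s = ⊥-elim (b≢s refl)
pigeonhole-pair (inj₂ refl) (inj₁ refl) (inj₁ refl) _   _   = refl

otherNeighbour-unique : (G : Graph) → MaxDegree≤2 G → ∀ {t s a b} →
  adj G t s ≡ true → adj G t a ≡ true → adj G t b ≡ true → a ≢ s → b ≢ s → a ≡ b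
otherNeighbour-unique G maxDegree {t} {s} {a} {b} ts ta tb a≢s b≢s =
  let p , q , within = maxDegree t in
  toℕ-injective (pigeonhole-pair (within s ts) (within a ta) (within b tb)
                           (a≢s ∘ toℕ-injective) (b≢s ∘ toℕ-injective))

-- If t has no neighbour of weight 0, then c = t will do.
freeNeighbour : (G : Graph) → MaxDegree≤2 G → {x : Fin (order G) → ℕ} {t s : Fin (order G)} →
  adj G t s ≡ true → x t ≡ 2 → x s ≡ 2 →
  ∃[ c ] (updateAt x t (const 0) c ≡ 0 × (∀ j → adj G t j ≡ true → x j ≡ 0 → j ≡ c))
freeNeighbour G maxDegree {x} {t} {s} ts xt xs with any? (λ c → (adj G t c ≟ᵇ true) ×-dec (x c ≟ 0))
... | no none = t , updateAt-updates t x , λ j tj xj → ⊥-elim (none (j , tj , xj))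
... | yes (c , tc , xc) =
  c , trans (updateAt-minimal c t x (≢2 xc xt)) xc ,
  λ j tj xj → otherNeighbour-unique G maxDegree ts tj tc (≢2 xj xs) (≢2 xc xs)
  where
  ≢2 : ∀ {a b} → x a ≡ 0 → x b ≡ 2 → a ≢ b
  ≢2 xa xb refl with trans (sym xa) xb
  ... | ()

module DropTwo
  {G : Graph} (G-sym : Symmetric G) (G-irr : Irreflexive G)
  {x : Fin (order G) → ℕ} (x-IsRDF : IsRDF G x) {t s : Fin (order G)}
  (ts : adj G t s ≡ true) (xt : x t ≡ 2) (xs : x s ≡ 2) {c : Fin (order G)}
  (c-free : updateAt x t (const 0) c ≡ 0)
  (c-unique : ∀ j → adj G t j ≡ true → x j ≡ 0 → j ≡ c) where

  private
    N = order G
    dropped : Fin N → ℕ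
    dropped = updateAt x t (const 0)

  lowered : Fin N → ℕ
  lowered = updateAt dropped c (const 1)

  lowered-off : ∀ {j} → j ≢ c → j ≢ t → lowered j ≡ x j
  lowered-off {j} j≢c j≢t = trans (updateAt-minimal j c dropped j≢c) (updateAt-minimal j t x j≢t)

  lowered-two : ∀ {w} → w ≢ t → x w ≡ 2 → lowered w ≡ 2
  lowered-two {w} w≢t xw = trans (lowered-off w≢c w≢t) xw
    where
    w≢c : w ≢ c
    w≢c refl with trans (sym c-free) (trans (updateAt-minimal w t x w≢t) xw)
    ... | ()

  lowered-IsRDF : IsRDF G lowered
  lowered-IsRDF = bounded , dominated
    where
    bounded : ∀ j → lowered j ≤ 2
    bounded j with j ≟ᶠ c | j ≟ᶠ t
    ... | yes refl | _        = subst (_≤ 2) (sym (updateAt-updates j dropped)) (s≤s z≤n)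
    ... | no j≢c   | yes refl = subst (_≤ 2) (sym (trans (updateAt-minimal j c dropped j≢c)
                                                         (updateAt-updates j x))) z≤n
    ... | no j≢c   | no j≢t   = subst (_≤ 2) (sym (lowered-off j≢c j≢t)) (proj₁ x-IsRDF j)
    dominated : ∀ j → lowered j ≡ 0 → ∃[ w ] (adj G j w ≡ true × lowered w ≡ 2)
    dominated j e with j ≟ᶠ c | j ≟ᶠ t
    ... | yes refl | _ with trans (sym (updateAt-updates j dropped)) e
    ...   | ()
    dominated j e | no j≢c | yes refl = s , ts , lowered-two s≢j xs
      where
      s≢j : s ≢ j
      s≢j refl = G-irr s ts
    dominated j e | no j≢c | no j≢t with proj₂ x-IsRDF j (trans (sym (lowered-off j≢c j≢t)) e)
    ... | w , jw , xw = w , jw , lowered-two w≢t xw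
      where
      w≢t : w ≢ t
      w≢t refl = j≢c (c-unique j (G-sym j w jw) (trans (sym (lowered-off j≢c j≢t)) e))

  lowered-weight : weight G lowered + 1 ≡ weight G x
  lowered-weight = begin
    ΣFin N lowered + 1           ≡⟨ cong (_+ 1) (+-identityʳ _) ⟨
    ΣFin N lowered + 0 + 1       ≡⟨ cong (λ a → ΣFin N lowered + a + 1) c-free ⟨
    ΣFin N lowered + dropped c + 1 ≡⟨ cong (_+ 1) (ΣFin-updateAt N dropped c (const 1)) ⟩
    ΣFin N dropped + 1 + 1       ≡⟨ +-assoc (ΣFin N dropped) 1 1 ⟩
    ΣFin N dropped + 2           ≡⟨ cong (ΣFin N dropped +_) xt ⟨
    ΣFin N dropped + x t         ≡⟨ ΣFin-updateAt N x t (const 0) ⟩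
    ΣFin N x + 0                 ≡⟨ +-identityʳ _ ⟩
    ΣFin N x                     ∎
    where open ≡-Reasoning

maxDegree≤2⇒TotalRDFsExceed : (G : Graph) → Symmetric G → Irreflexive G → MaxDegree≤2 G →
  Fin (order G) → ∀ {k} → RDFsWeighAtLeast G k → TotalRDFsExceed G k
maxDegree≤2⇒TotalRDFsExceed G G-sym G-irr maxDegree v {k} atLeast x x-IsRDF totally
  with totally v
... | t , _ , xt with totally t
... | s , ts , xs with freeNeighbour G maxDegree ts xt xs
... | c , c-free , c-unique =
  subst (_≤ weight G x) (+-comm k 1)
        (subst (k + 1 ≤_) lowered-weight (+-monoˡ-≤ 1 (atLeast lowered lowered-IsRDF)))
  where open DropTwo G-sym G-irr x-IsRDF ts xt xs c-free c-unique

∨-true : ∀ {a b} → a ∨ b ≡ true → a ≡ true ⊎ b ≡ true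
∨-true {true}  _ = inj₁ refl
∨-true {false} e = inj₂ e

∧-true : ∀ {a b} → a ∧ b ≡ true → a ≡ true × b ≡ true
∧-true {true} e = refl , e

≡ᵇ-sound : ∀ {m n} → (m ≡ᵇ n) ≡ true → m ≡ n
≡ᵇ-sound {m} {n} e = ≡ᵇ⇒≡ m n (Equivalence.from T-≡ e)

≡ᵇ-complete : ∀ {m n} → m ≡ n → (m ≡ᵇ n) ≡ true
≡ᵇ-complete {m} {n} e = Equivalence.to T-≡ (≡⇒≡ᵇ m n e)

≡ᵇ-comm : ∀ m n → (m ≡ᵇ n) ≡ (n ≡ᵇ m)
≡ᵇ-comm zero    zero    = refl
≡ᵇ-comm zero    (suc n) = refl
≡ᵇ-comm (suc m) zero    = refl
≡ᵇ-comm (suc m) (suc n) = ≡ᵇ-comm m n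

unequalLabels : {n : ℕ} → (Fin n → ℕ) → Graph
unequalLabels {n} φ = record { order = n ; adj = λ i j → not (φ i ≡ᵇ φ j) }

unequalLabels-symmetric : ∀ {n} (φ : Fin n → ℕ) → Symmetric (unequalLabels φ)
unequalLabels-symmetric φ i j = trans (cong not (≡ᵇ-comm (φ j) (φ i)))

unequalLabels-irreflexive : ∀ {n} (φ : Fin n → ℕ) → Irreflexive (unequalLabels φ)
unequalLabels-irreflexive φ i e with trans (sym e) (cong not (≡ᵇ-complete {φ i} refl))
... | ()

zeroDominates-γR≤2 : ∀ {m} (A : Fin (suc m) → Fin (suc m) → Bool) →
  (∀ j → A (suc j) zero ≡ true) →
  ∀ {k} → RDFsWeighAtLeast (record { order = suc m ; adj = A }) k → k ≤ 2
zeroDominates-γR≤2 {m} A dominates atLeast =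
  ≤-trans (atLeast f (bounded , dominated)) (≤-reflexive (cong (2 +_) (ΣFin-zero m)))
  where
  f : Fin (suc m) → ℕ
  f zero    = 2
  f (suc _) = 0
  bounded : ∀ j → f j ≤ 2
  bounded zero    = ≤-refl
  bounded (suc _) = z≤n
  dominated : ∀ j → f j ≡ 0 → ∃[ w ] (A j w ≡ true × f w ≡ 2)
  dominated (suc j) _ = zero , dominates j , refl

zeroAlmostDominates-γR≤3 : ∀ {m} (A : Fin (2 + m) → Fin (2 + m) → Bool) →
  (∀ j → A (suc (suc j)) zero ≡ true) →
  ∀ {k} → RDFsWeighAtLeast (record { order = 2 + m ; adj = A }) k → k ≤ 3
zeroAlmostDominates-γR≤3 {m} A dominates atLeast =
  ≤-trans (atLeast f (bounded , dominated)) (≤-reflexive (cong (λ s → 2 + (1 + s)) (ΣFin-zero m)))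
  where
  f : Fin (2 + m) → ℕ
  f zero          = 2
  f (suc zero)    = 1
  f (suc (suc _)) = 0
  bounded : ∀ j → f j ≤ 2
  bounded zero          = ≤-refl
  bounded (suc zero)    = s≤s z≤n
  bounded (suc (suc _)) = z≤n
  dominated : ∀ j → f j ≡ 0 → ∃[ w ] (A j w ≡ true × f w ≡ 2)
  dominated (suc (suc j)) _ = zero , dominates j , refl

complete-TotalRDFsExceed : ∀ m {k} → RDFsWeighAtLeast (completeGraph (suc m)) k →
  TotalRDFsExceed (completeGraph (suc m)) k
complete-TotalRDFsExceed m atLeast =
  γR≤3⇒TotalRDFsExceed _ (unequalLabels-irreflexive toℕ) zero
    (≤-trans (zeroDominates-γR≤2 neq (λ _ → refl) atLeast) (n≤1+n 2))

star-symmetric : ∀ n → Symmetric (starGraph n)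
star-symmetric n zero    (suc j) _ = refl
star-symmetric n (suc i) zero    _ = refl

star-irreflexive : ∀ n → Irreflexive (starGraph n)
star-irreflexive n zero    ()
star-irreflexive n (suc i) ()

star-TotalRDFsExceed : ∀ n {k} → RDFsWeighAtLeast (starGraph n) k → TotalRDFsExceed (starGraph n) k
star-TotalRDFsExceed n atLeast =
  γR≤3⇒TotalRDFsExceed _ (star-irreflexive n) zero
    (≤-trans (zeroDominates-γR≤2 starAdj (λ _ → refl) atLeast) (n≤1+n 2))

multipartite-TotalRDFsExceed : ∀ m ms {k} → RDFsWeighAtLeast (completeMultipartite (2 ∷ m ∷ ms)) k →
  TotalRDFsExceed (completeMultipartite (2 ∷ m ∷ ms)) k
multipartite-TotalRDFsExceed m ms atLeast =
  γR≤3⇒TotalRDFsExceed _ (unequalLabels-irreflexive (partOf (2 ∷ m ∷ ms))) zero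
    (zeroAlmostDominates-γR≤3 (adj (completeMultipartite (2 ∷ m ∷ ms))) (λ _ → refl) atLeast)

consecutive-view : ∀ {n} (i j : Fin n) → consecutive i j ≡ true →
  suc (toℕ i) ≡ toℕ j ⊎ suc (toℕ j) ≡ toℕ i
consecutive-view i j e = Data.Sum.map ≡ᵇ-sound ≡ᵇ-sound (∨-true e)

consecutive-irreflexive : ∀ {n} (i : Fin n) → ¬ consecutive i i ≡ true
consecutive-irreflexive i e = Data.Sum.[ 1+n≢n , 1+n≢n ] (consecutive-view i i e)

path-symmetric : ∀ n → Symmetric (pathGraph n)
path-symmetric n i j = trans (∨-comm (suc (toℕ j) ≡ᵇ toℕ i) (suc (toℕ i) ≡ᵇ toℕ j))

path-irreflexive : ∀ n → Irreflexive (pathGraph n)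
path-irreflexive n = consecutive-irreflexive

path-maxDegree≤2 : ∀ n → MaxDegree≤2 (pathGraph n)
path-maxDegree≤2 n t =
  suc (toℕ t) , pred (toℕ t) , λ a ta → Data.Sum.map sym (cong pred) (consecutive-view t a ta)

cycleAdj-view : ∀ n (i j : Fin n) → cycleAdj n i j ≡ true →
  (suc (toℕ i) ≡ toℕ j ⊎ suc (toℕ j) ≡ toℕ i) ⊎
  (toℕ i ≡ 0 × suc (toℕ j) ≡ n) ⊎ (toℕ j ≡ 0 × suc (toℕ i) ≡ n)
cycleAdj-view n i j e with ∨-true e
... | inj₁ ij = inj₁ (consecutive-view i j ij)
... | inj₂ wrap with ∨-true wrap
...   | inj₁ ij = inj₂ (inj₁ (Data.Product.map ≡ᵇ-sound ≡ᵇ-sound (∧-true ij)))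
...   | inj₂ ji = inj₂ (inj₂ (Data.Product.map ≡ᵇ-sound ≡ᵇ-sound (∧-true ji)))

cycle-symmetric : ∀ n → Symmetric (cycleGraph n)
cycle-symmetric n i j = trans (cong₂ _∨_
  (∨-comm (suc (toℕ j) ≡ᵇ toℕ i) (suc (toℕ i) ≡ᵇ toℕ j))
  (∨-comm ((toℕ j ≡ᵇ 0) ∧ (suc (toℕ i) ≡ᵇ n)) ((toℕ i ≡ᵇ 0) ∧ (suc (toℕ j) ≡ᵇ n))))

cycle-irreflexive : ∀ n → 3 ≤ n → Irreflexive (cycleGraph n)
cycle-irreflexive n 3≤n i e with cycleAdj-view n i i e
... | inj₁ ii   = Data.Sum.[ 1+n≢n , 1+n≢n ] ii
... | inj₂ ends = let i≡0 , 1+i≡n = reduce ends in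
                  3≰1 (subst (3 ≤_) (trans (sym 1+i≡n) (cong suc i≡0)) 3≤n)
  where
  3≰1 : ¬ 3 ≤ 1
  3≰1 (s≤s ())

cycleSucc : ℕ → ℕ → ℕ
cycleSucc n t = if suc t ≡ᵇ n then 0 else suc t

cyclePred : ℕ → ℕ → ℕ
cyclePred n zero    = pred n
cyclePred n (suc t) = t

cycle-maxDegree≤2 : ∀ n → MaxDegree≤2 (cycleGraph n)
cycle-maxDegree≤2 n t = cycleSucc n (toℕ t) , cyclePred n (toℕ t) ,
  λ a ta → neighbour (toℕ t) (toℕ a) (toℕ<n a) (cycleAdj-view n t a ta)
  where
  neighbour : ∀ t a → a < n →
    (suc t ≡ a ⊎ suc a ≡ t) ⊎ (t ≡ 0 × suc a ≡ n) ⊎ (a ≡ 0 × suc t ≡ n) →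
    a ≡ cycleSucc n t ⊎ a ≡ cyclePred n t
  neighbour t a a<n (inj₁ (inj₁ refl)) with suc t ≡ᵇ n in last
  ... | true  = ⊥-elim (<-irrefl (≡ᵇ-sound last) a<n)
  ... | false = inj₁ refl
  neighbour t a a<n (inj₁ (inj₂ refl)) = inj₂ refl
  neighbour t a a<n (inj₂ (inj₁ (refl , 1+a≡n))) = inj₂ (cong pred 1+a≡n)
  neighbour t a a<n (inj₂ (inj₂ (refl , 1+t≡n))) rewrite ≡ᵇ-complete 1+t≡n = inj₁ refl

cycle-TotalRDFsExceed : ∀ n → 3 ≤ n → ∀ {k} → RDFsWeighAtLeast (cycleGraph n) k →
  TotalRDFsExceed (cycleGraph n) k
cycle-TotalRDFsExceed (suc n) 3≤n =
  maxDegree≤2⇒TotalRDFsExceed _ (cycle-symmetric (suc n)) (cycle-irreflexive (suc n) 3≤n)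
    (cycle-maxDegree≤2 (suc n)) zero

path-TotalRDFsExceed : ∀ n {k} → RDFsWeighAtLeast (pathGraph (suc n)) k →
  TotalRDFsExceed (pathGraph (suc n)) k
path-TotalRDFsExceed n =
  maxDegree≤2⇒TotalRDFsExceed _ (path-symmetric (suc n)) (path-irreflexive (suc n))
    (path-maxDegree≤2 (suc n)) zero

petersen-symmetric : Symmetric petersen
petersen-symmetric = from-yes (all? λ i → all? λ j →
  (adj petersen i j ≟ᵇ true) →-dec (adj petersen j i ≟ᵇ true))

petersen-irreflexive : Irreflexive petersen
petersen-irreflexive = from-yes (all? λ i → ¬? (adj petersen i i ≟ᵇ true))

petersen-degree≤3 : ∀ w → degree petersen w ≤ 3
petersen-degree≤3 = from-yes (all? λ w → degree petersen w ≤? 3)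

petersenRDF : Fin 10 → ℕ
petersenRDF i = if (toℕ i ≡ᵇ 0) ∨ (toℕ i ≡ᵇ 2) ∨ (toℕ i ≡ᵇ 6) then 2 else 0

petersenRDF-IsRDF : IsRDF petersen petersenRDF
petersenRDF-IsRDF =
  from-yes (all? λ i → petersenRDF i ≤? 2) ,
  from-yes (all? λ i → (petersenRDF i ≟ 0) →-dec
                       any? λ w → (adj petersen i w ≟ᵇ true) ×-dec (petersenRDF w ≟ 2))

petersen-TotalRDFsExceed : ∀ {k} → RDFsWeighAtLeast petersen k → TotalRDFsExceed petersen k
petersen-TotalRDFsExceed {k} atLeast f _ totally = begin-strict
  k              ≤⟨ atLeast petersenRDF petersenRDF-IsRDF ⟩
  6              <⟨ n<1+n 6 ⟩
  7              <⟨ n<1+n 7 ⟩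
  2 * 4          ≤⟨ *-monoʳ-≤ 2 4≤twos ⟩
  2 * twos f     ≤⟨ 2*twos≤ΣFin 10 f ⟩
  weight petersen f ∎
  where
  open ≤-Reasoning
  4≤twos : 4 ≤ twos f
  4≤twos = ≰⇒> λ twos≤3 → <-irrefl refl
    (≤-trans (order≤degree*twos petersen petersen-degree≤3 f totally) (*-monoʳ-≤ 3 twos≤3))

corollary1 : (G : Graph) →
    ((∃[ n ] (1 ≤ n × G ≡ completeGraph n)) ⊎
     (∃[ n ] (1 ≤ n × G ≡ pathGraph n)) ⊎
     (∃[ n ] (1 ≤ n × G ≡ starGraph n)) ⊎
     (∃[ n ] (3 ≤ n × G ≡ cycleGraph n)) ⊎
     (∃[ m ] ∃[ ms ] (Linked _≤_ (2 ∷ m ∷ ms) × G ≡ completeMultipartite (2 ∷ m ∷ ms))) ⊎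
     (G ≡ petersen)) →
    (k : ℕ) → RomanDominationNumber G k → RomanDominationNumber (μ G) (k + 2)
corollary1 _ (inj₁ (suc n , _ , refl)) k γR =
  γR-μ (unequalLabels-symmetric toℕ) (unequalLabels-irreflexive toℕ) γR
       (complete-TotalRDFsExceed n (proj₂ γR))
corollary1 _ (inj₂ (inj₁ (suc n , _ , refl))) k γR =
  γR-μ (path-symmetric (suc n)) (path-irreflexive (suc n)) γR (path-TotalRDFsExceed n (proj₂ γR))
corollary1 _ (inj₂ (inj₂ (inj₁ (n , _ , refl)))) k γR =
  γR-μ (star-symmetric n) (star-irreflexive n) γR (star-TotalRDFsExceed n (proj₂ γR))
corollary1 _ (inj₂ (inj₂ (inj₂ (inj₁ (n , 3≤n , refl))))) k γR =
  γR-μ (cycle-symmetric n) (cycle-irreflexive n 3≤n) γR (cycle-TotalRDFsExceed n 3≤n (proj₂ γR))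
corollary1 _ (inj₂ (inj₂ (inj₂ (inj₂ (inj₁ (m , ms , _ , refl)))))) k γR =
  -- only the leading part of size 2 matters; the part sizes need not be sorted
  γR-μ (unequalLabels-symmetric (partOf (2 ∷ m ∷ ms))) (unequalLabels-irreflexive (partOf (2 ∷ m ∷ ms)))
       γR (multipartite-TotalRDFsExceed m ms (proj₂ γR))
corollary1 _ (inj₂ (inj₂ (inj₂ (inj₂ (inj₂ refl))))) k γR =
  γR-μ petersen-symmetric petersen-irreflexive γR (petersen-TotalRDFsExceed (proj₂ γR))
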